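{- For every non-negative integer $n$, $$(-27)^n\sum_{k=0}^n\left(\frac{(1/3)_k(2/3)_{n-k}}{(1)_k(1)_{n-k}}\right)^2=\sum_{k=0}^n\binom{3k}{k}\binom{2k}{k}^2\binom{n+k}{n-k}(-27)^{n-k}.$$
   Context: $(\alpha)_n=\alpha(\alpha+1)\cdots(\alpha+n-1)$ denotes the Pochhammer symbol, with $(\alpha)_0=1$. -}

module Defs where

open import Data.Nat as ℕ using (ℕ; zero; suc; _∸_)
open import Data.Nat.Combinatorics using (_C_)
open import Data.Integer as ℤ using (+_; -[1+_])
open import Data.Rational using (ℚ; _+_; _*_; _/_; 0ℚ; 1ℚ; _÷_; Positive; NonNegative)
open import Data.Rational.Properties using (pos+pos⇒pos; nonNeg+pos⇒pos; pos*pos⇒pos; pos⇒nonZero; pos⇒nonNeg)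
open import Data.Rational as Q using (NonZero)

_^ℚ_ : ℚ → ℕ → ℚ
q ^ℚ zero  = 1ℚ
q ^ℚ suc n = q * (q ^ℚ n)

ℕ→ℚ : ℕ → ℚ
ℕ→ℚ n = + n / 1

poch : ℚ → ℕ → ℚ
poch α zero    = 1ℚ
poch α (suc n) = poch α n * (α + ℕ→ℚ n)

sumTo : ℕ → (ℕ → ℚ) → ℚ
sumTo zero    f = f 0
sumTo (suc n) f = sumTo n f + f (suc n)

poch1-pos : ∀ n → Positive (poch 1ℚ n)
poch1-pos zero = _
poch1-pos (suc n) =
  pos*pos⇒pos (poch 1ℚ n) {{poch1-pos n}} (1ℚ + ℕ→ℚ n)
    {{pos+nonNeg 1ℚ (ℕ→ℚ n) {{Data.Rational.Properties.normalize-nonNeg n 1}}}}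
  where
  pos+nonNeg : ∀ p .{{_ : Positive p}} q .{{_ : NonNegative q}} → Positive (p + q)
  pos+nonNeg = Data.Rational.Properties.pos+nonNeg⇒pos

poch1-nonZero : ∀ n → NonZero (poch 1ℚ n)
poch1-nonZero n = pos⇒nonZero (poch 1ℚ n) {{poch1-pos n}}

_÷poch1_ : ℚ → ℕ → ℚ
q ÷poch1 n = _÷_ q (poch 1ℚ n) {{poch1-nonZero n}}

m27 : ℚ
m27 = -[1+ 26 ] / 1

lhsTerm : ℕ → ℕ → ℚ
lhsTerm n k = r * r
  where
  r : ℚ
  r = ((poch (+ 1 / 3) k * poch (+ 2 / 3) (n ∸ k)) ÷poch1 k) ÷poch1 (n ∸ k)

rhsTerm : ℕ → ℕ → ℚ
rhsTerm n k =
  ℕ→ℚ (((3 ℕ.* k) C k) ℕ.* ((2 ℕ.* k) C k) ℕ.* ((2 ℕ.* k) C k) ℕ.* ((n ℕ.+ k) C (n ∸ k)))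
    * (m27 ^ℚ (n ∸ k))

-- Both sides are sums over the antidiagonal k + j = n of hypergeometric double sequences:
-- (α_k β_j)² with α_k = (1/3)_k / k! and β_j = (2/3)_j / j! on the left, and
-- C(3k,k) C(2k,k)² C(j+2k,j) (-27)^j on the right. Creative telescoping with explicit
-- certificates shows that the left sum S(n) satisfies
--   (n+2)³ S(n+2) - (2n+3)(27n²+81n+69)/27 S(n+1) + (n+1)³ S(n) = 0,
-- so that (-27)ⁿ S(n) satisfies
--   (n+2)³ u(n+2) + (2n+3)(27n²+81n+69) u(n+1) + 729 (n+1)³ u(n) = 0,
-- and so does the right sum. The leading coefficient never vanishes and both sides agree
-- at n = 0 and n = 1, hence everywhere. Divided by a suitable hypergeometric term, every
-- certificate identity becomes a polynomial identity, which the ring solver checks.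

module Submission where

module Binomial where

  open import Data.Nat.Base using (ℕ; suc; _∸_; _+_; _*_; _^_; _/_; _!; NonZero)
  open import Data.Nat.Combinatorics using (_C_; nCk≡n!/k![n-k]!; k![n∸k]!∣n!)
  open import Data.Nat.DivMod using (m/n*n≡m)
  import Data.Nat.Properties as ℕₚ
  open import Data.Nat.Properties using (_!≢0; _!*_!≢0)
  open import Data.Nat.Tactic.RingSolver using (solve-∀)
  open import Relation.Binary.PropositionalEquality using (_≡_; sym; cong; cong₂; subst; module ≡-Reasoning)

  C-factorial : ∀ a b → ((a + b) C a) * (a ! * b !) ≡ (a + b) !
  C-factorial a b = begin
    ((a + b) C a) * (a ! * b !)                 ≡⟨ cong (λ c → ((a + b) C a) * (a ! * c !)) (sym (ℕₚ.m+n∸m≡n a b)) ⟩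
    ((a + b) C a) * (a ! * (a + b ∸ a) !)       ≡⟨ cong (_* (a ! * (a + b ∸ a) !)) (nCk≡n!/k![n-k]! a≤a+b) ⟩
    ((a + b) ! / (a ! * (a + b ∸ a) !)) * (a ! * (a + b ∸ a) !)
                                              ≡⟨ m/n*n≡m (k![n∸k]!∣n! a≤a+b) ⟩
    (a + b) !                                 ∎
    where
    open ≡-Reasoning
    a≤a+b = ℕₚ.m≤m+n a b
    instance
      _ : NonZero (a ! * (a + b ∸ a) !)
      _ = a !* (a + b ∸ a) !≢0

  C-absorb : ∀ j M → suc j * ((suc j + M) C suc j) ≡ suc (j + M) * ((j + M) C j)
  C-absorb j M = ℕₚ.*-cancelʳ-≡ _ _ (j ! * M !) {{j !* M !≢0}} (begin
    suc j * C₁ * (j ! * M !)          ≡⟨ regroup (suc j) C₁ (j !) (M !) ⟩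
    C₁ * (suc j ! * M !)              ≡⟨ C-factorial (suc j) M ⟩
    suc (j + M) * (j + M) !           ≡⟨ cong (suc (j + M) *_) (sym (C-factorial j M)) ⟩
    suc (j + M) * (C₀ * (j ! * M !))  ≡⟨ sym (ℕₚ.*-assoc (suc (j + M)) C₀ (j ! * M !)) ⟩
    suc (j + M) * C₀ * (j ! * M !)    ∎)
    where
    open ≡-Reasoning
    C₁ = (suc j + M) C suc j
    C₀ = (j + M) C j
    regroup : ∀ a c f g → a * c * (f * g) ≡ c * (a * f * g)
    regroup = solve-∀

  C-shift₂ : ∀ m M → suc (suc M) * suc M * ((m + suc (suc M)) C m) ≡ suc (suc (m + M)) * suc (m + M) * ((m + M) C m)
  C-shift₂ m M = ℕₚ.*-cancelʳ-≡ _ _ (m ! * M !) {{m !* M !≢0}} (begin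
    suc (suc M) * suc M * C₂ * (m ! * M !)     ≡⟨ regroup (suc (suc M)) (suc M) C₂ (m !) (M !) ⟩
    C₂ * (m ! * suc (suc M) !)                 ≡⟨ C-factorial m (suc (suc M)) ⟩
    (m + suc (suc M)) !                        ≡⟨ cong _! (plus-two m M) ⟩
    suc (suc (m + M)) * (suc (m + M) * (m + M) !)
                                               ≡⟨ cong (λ t → suc (suc (m + M)) * (suc (m + M) * t)) (sym (C-factorial m M)) ⟩
    suc (suc (m + M)) * (suc (m + M) * (C₀ * (m ! * M !)))
                                               ≡⟨ reassociate (suc (suc (m + M))) (suc (m + M)) C₀ (m ! * M !) ⟩
    suc (suc (m + M)) * suc (m + M) * C₀ * (m ! * M !) ∎)
    where
    open ≡-Reasoning
    C₂ = (m + suc (suc M)) C m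
    C₀ = (m + M) C m
    regroup : ∀ a b c f g → a * b * c * (f * g) ≡ c * (f * (a * (b * g)))
    regroup = solve-∀
    plus-two : ∀ m M → m + suc (suc M) ≡ suc (suc (m + M))
    plus-two = solve-∀
    reassociate : ∀ a b c d → a * (b * (c * d)) ≡ a * b * c * d
    reassociate = solve-∀

  weightR : ℕ → ℕ
  weightR k = ((3 * k) C k) * ((2 * k) C k) * ((2 * k) C k)

  weightR-factorial : ∀ k → weightR k * (k !) ^ 5 ≡ (3 * k) ! * (2 * k) !
  weightR-factorial k = ℕₚ.*-cancelʳ-≡ _ _ ((2 * k) !) {{(2 * k) !≢0}} (begin
    weightR k * (k !) ^ 5 * (2 * k) !
      ≡⟨ regroup ((3 * k) C k) ((2 * k) C k) (k !) ((2 * k) !) ⟩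
    ((3 * k) C k) * (k ! * (2 * k) !) * (((2 * k) C k) * (k ! * k !)) * (((2 * k) C k) * (k ! * k !))
      ≡⟨ cong₂ _*_ (cong₂ _*_ (C-factorial k (2 * k)) central) central ⟩
    (3 * k) ! * (2 * k) ! * (2 * k) ! ∎)
    where
    open ≡-Reasoning
    regroup : ∀ a b f g → a * b * b * (f * (f * (f * (f * (f * 1))))) * g ≡ a * (f * g) * (b * (f * f)) * (b * (f * f))
    regroup = solve-∀
    central : ((2 * k) C k) * (k ! * k !) ≡ (2 * k) !
    central = subst (λ n → ((2 * k) C k) * (k ! * n !) ≡ (2 * k) !) (ℕₚ.*-identityˡ k) (C-factorial k (1 * k))

  weightR-suc : ∀ k → suc k * (suc k * suc k) * weightR (suc k)
                      ≡ 6 * (suc (suc (3 * k)) * (suc (3 * k) * suc (2 * k))) * weightR k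
  weightR-suc k = ℕₚ.*-cancelʳ-≡ _ _ ((k !) ^ 5 * (suc k * suc k)) {{nonZero}} (begin
    suc k * (suc k * suc k) * weightR (suc k) * ((k !) ^ 5 * (suc k * suc k))
      ≡⟨ regroup₁ (suc k) (k !) (weightR (suc k)) ⟩
    weightR (suc k) * (suc k !) ^ 5
      ≡⟨ weightR-factorial (suc k) ⟩
    (3 * suc k) ! * (2 * suc k) !
      ≡⟨ cong₂ (λ a b → a ! * b !) (three k) (two k) ⟩
    suc (suc (suc (3 * k))) ! * suc (suc (2 * k)) !
      ≡⟨ regroup₂ k ((3 * k) !) ((2 * k) !) ⟩
    P * (suc k * suc k) * ((3 * k) ! * (2 * k) !)
      ≡⟨ cong (P * (suc k * suc k) *_) (sym (weightR-factorial k)) ⟩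
    P * (suc k * suc k) * (weightR k * (k !) ^ 5)
      ≡⟨ regroup₃ P (suc k * suc k) (weightR k) ((k !) ^ 5) ⟩
    P * weightR k * ((k !) ^ 5 * (suc k * suc k)) ∎)
    where
    open ≡-Reasoning
    P = 6 * (suc (suc (3 * k)) * (suc (3 * k) * suc (2 * k)))
    nonZero : NonZero ((k !) ^ 5 * (suc k * suc k))
    nonZero = ℕₚ.m*n≢0 _ _ {{ℕₚ.m^n≢0 (k !) 5 {{k !≢0}}}}
    regroup₁ : ∀ s f w → s * (s * s) * w * (f * (f * (f * (f * (f * 1)))) * (s * s))
                         ≡ w * (s * f * (s * f * (s * f * (s * f * (s * f * 1)))))
    regroup₁ = solve-∀
    three : ∀ k → 3 * suc k ≡ suc (suc (suc (3 * k)))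
    three = solve-∀
    two : ∀ k → 2 * suc k ≡ suc (suc (2 * k))
    two = solve-∀
    regroup₂ : ∀ k x y →
      suc (suc (suc (3 * k))) * (suc (suc (3 * k)) * (suc (3 * k) * x)) * (suc (suc (2 * k)) * (suc (2 * k) * y))
                         ≡ 6 * (suc (suc (3 * k)) * (suc (3 * k) * suc (2 * k))) * (suc k * suc k) * (x * y)
    regroup₂ = solve-∀
    regroup₃ : ∀ p s w g → p * s * (w * g) ≡ p * w * (g * s)
    regroup₃ = solve-∀

  weightR-shift : ∀ k m →
    suc k * suc k * (suc k * suc k) * (weightR (suc k) * ((m + 2 * suc k) C m))
      ≡ 3 * (suc (suc (3 * k)) * suc (3 * k)) * (suc (suc (m + 2 * k)) * suc (m + 2 * k)) * (weightR k * ((m + 2 * k) C m))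
  weightR-shift k m = ℕₚ.*-cancelʳ-≡ _ _ (2 * suc (2 * k)) (begin
    suc k * suc k * (suc k * suc k) * (weightR (suc k) * ((m + 2 * suc k) C m)) * (2 * suc (2 * k))
      ≡⟨ cong (λ t → suc k * suc k * (suc k * suc k) * (weightR (suc k) * ((m + t) C m)) * (2 * suc (2 * k))) (two k) ⟩
    suc k * suc k * (suc k * suc k) * (weightR (suc k) * C₂) * (2 * suc (2 * k))
      ≡⟨ regroup₁ k (weightR (suc k)) C₂ ⟩
    (suc k * (suc k * suc k) * weightR (suc k)) * (suc (suc (2 * k)) * suc (2 * k) * C₂)
      ≡⟨ cong₂ _*_ (weightR-suc k) (C-shift₂ m (2 * k)) ⟩
    6 * (suc (suc (3 * k)) * (suc (3 * k) * suc (2 * k))) * weightR k * (suc (suc (m + 2 * k)) * suc (m + 2 * k) * C₀)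
      ≡⟨ regroup₂ k (m + 2 * k) (weightR k) C₀ ⟩
    3 * (suc (suc (3 * k)) * suc (3 * k)) * (suc (suc (m + 2 * k)) * suc (m + 2 * k)) * (weightR k * C₀) * (2 * suc (2 * k)) ∎)
    where
    open ≡-Reasoning
    C₂ = (m + suc (suc (2 * k))) C m
    C₀ = (m + 2 * k) C m
    two : ∀ k → 2 * suc k ≡ suc (suc (2 * k))
    two = solve-∀
    regroup₁ : ∀ k w c → suc k * suc k * (suc k * suc k) * (w * c) * (2 * suc (2 * k))
                         ≡ suc k * (suc k * suc k) * w * (suc (suc (2 * k)) * suc (2 * k) * c)
    regroup₁ = solve-∀
    regroup₂ : ∀ k u w c → 6 * (suc (suc (3 * k)) * (suc (3 * k) * suc (2 * k))) * w * (suc (suc u) * suc u * c)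
                           ≡ 3 * (suc (suc (3 * k)) * suc (3 * k)) * (suc (suc u) * suc u) * (w * c) * (2 * suc (2 * k))
    regroup₂ = solve-∀

open import Level using (0ℓ)
open import Data.Product.Base using (_×_; _,_; proj₁; proj₂)
open import Function.Base using (_∘_)
open import Data.Nat.Base as ℕ using (ℕ; zero; suc; _∸_; _≤_)
open import Data.Nat.Combinatorics using (_C_)
import Data.Nat.Coprimality as Coprime
import Data.Nat.Properties as ℕₚ
import Data.Nat.Tactic.RingSolver as ℕSolver
open import Data.Integer.Base as ℤ using (+_)
import Data.Integer.Properties as ℤₚ
open import Data.Rational.Base as ℚ
  using (ℚ; mkℚ; _+_; _*_; _-_; -_; _/_; _÷_; 1/_; 0ℚ; 1ℚ; NonZero; Positive; NonNegative)
import Data.Rational.Properties as ℚₚ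
open import Relation.Nullary.Decidable.Core using (dec⇒maybe)
open import Relation.Binary.PropositionalEquality
  using (_≡_; refl; sym; trans; cong; cong₂; subst; subst₂; module ≡-Reasoning)
open import Tactic.RingSolver using (solve-∀)
import Tactic.RingSolver.Core.AlmostCommutativeRing as ACR

open import Defs

open Binomial using (C-absorb; weightR; weightR-shift)

-- The ring solver treats defined functions as opaque constants, so identities mentioning
-- sq or the polynomials below restate them in a local let; conversion at each use
-- checks the restatement against the definition.
ℚ-ring : ACR.AlmostCommutativeRing 0ℓ 0ℓ
ℚ-ring = ACR.fromCommutativeRing ℚₚ.+-*-commutativeRing (λ x → dec⇒maybe (0ℚ ℚₚ.≟ x))

sq : ℚ → ℚ
sq x = x * x

-- Unlike ℕ→ℚ, this embedding satisfies ι (suc n) ≡ ι n + 1ℚ by definition, so shifted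
-- indices appear directly as shifted variables in polynomial identities.
ι : ℕ → ℚ
ι zero    = 0ℚ
ι (suc n) = ι n + 1ℚ

ℕ→ℚ-+ : ∀ m n → ℕ→ℚ (m ℕ.+ n) ≡ ℕ→ℚ m + ℕ→ℚ n
ℕ→ℚ-+ m n = begin
  (+ m ℤ.+ + n) / 1
    ≡⟨ cong₂ (λ a b → (a ℤ.+ b) / 1) (sym (ℤₚ.*-identityʳ (+ m))) (sym (ℤₚ.*-identityʳ (+ n))) ⟩
  (+ m ℤ.* + 1 ℤ.+ + n ℤ.* + 1) / 1
    ≡⟨ cong₂ _+_ (sym (integral m)) (sym (integral n)) ⟩
  ℕ→ℚ m + ℕ→ℚ n ∎
  where
  open ≡-Reasoning
  integral : ∀ k → ℕ→ℚ k ≡ mkℚ (+ k) 0 (Coprime.sym (Coprime.1-coprimeTo k))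
  integral k = ℚₚ.normalize-coprime (Coprime.sym (Coprime.1-coprimeTo k))

ℕ→ℚ≡ι : ∀ n → ℕ→ℚ n ≡ ι n
ℕ→ℚ≡ι zero    = refl
ℕ→ℚ≡ι (suc n) = begin
  ℕ→ℚ (suc n)       ≡⟨ cong ℕ→ℚ (ℕₚ.+-comm 1 n) ⟩
  ℕ→ℚ (n ℕ.+ 1)     ≡⟨ ℕ→ℚ-+ n 1 ⟩
  ℕ→ℚ n + 1ℚ        ≡⟨ cong (_+ 1ℚ) (ℕ→ℚ≡ι n) ⟩
  ι n + 1ℚ          ∎
  where open ≡-Reasoning

ι-+ : ∀ m n → ι (m ℕ.+ n) ≡ ι m + ι n
ι-+ zero    n = sym (ℚₚ.+-identityˡ (ι n))
ι-+ (suc m) n = trans (cong (_+ 1ℚ) (ι-+ m n)) (shift (ι m) (ι n))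
  where
  shift : ∀ x y → x + y + 1ℚ ≡ x + 1ℚ + y
  shift = solve-∀ ℚ-ring

ι-* : ∀ m n → ι (m ℕ.* n) ≡ ι m * ι n
ι-* zero    n = sym (ℚₚ.*-zeroˡ (ι n))
ι-* (suc m) n = trans (ι-+ n (m ℕ.* n)) (trans (cong (λ t → ι n + t) (ι-* m n)) (distrib (ι m) (ι n)))
  where
  distrib : ∀ x y → y + x * y ≡ (x + 1ℚ) * y
  distrib = solve-∀ ℚ-ring

ι-cast : ∀ a x b y → a ℕ.* x ≡ b ℕ.* y → ι a * ι x ≡ ι b * ι y
ι-cast a x b y eq = trans (sym (ι-* a x)) (trans (cong ι eq) (ι-* b y))

ι-+2* : ∀ j k → ι (j ℕ.+ 2 ℕ.* k) ≡ ι j + + 2 / 1 * ι k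
ι-+2* j k = trans (ι-+ j (2 ℕ.* k)) (cong (λ t → ι j + t) (ι-* 2 k))

ι-*-* : ∀ a b c d → ι (a ℕ.* b ℕ.* (c ℕ.* d)) ≡ ι a * ι b * (ι c * ι d)
ι-*-* a b c d = trans (ι-* (a ℕ.* b) (c ℕ.* d)) (cong₂ _*_ (ι-* a b) (ι-* c d))

ι-nonNegative : ∀ n → NonNegative (ι n)
ι-nonNegative zero    = _
ι-nonNegative (suc n) = ℚₚ.nonNeg+nonNeg⇒nonNeg (ι n) {{ι-nonNegative n}} 1ℚ

ι-suc-positive : ∀ n → Positive (ι (suc n))
ι-suc-positive n = ℚₚ.nonNeg+pos⇒pos (ι n) {{ι-nonNegative n}} 1ℚ

ι-suc-nonZero : ∀ n → NonZero (ι (suc n))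
ι-suc-nonZero n = ℚₚ.pos⇒nonZero (ι (suc n)) {{ι-suc-positive n}}

*-cancelˡ-≡ : ∀ c .{{_ : NonZero c}} {x y} → c * x ≡ c * y → x ≡ y
*-cancelˡ-≡ c {x} {y} eq = begin
  x                ≡⟨ unit x ⟩
  1/ c * c * x     ≡⟨ ℚₚ.*-assoc (1/ c) c x ⟩
  1/ c * (c * x)   ≡⟨ cong (1/ c *_) eq ⟩
  1/ c * (c * y)   ≡⟨ sym (ℚₚ.*-assoc (1/ c) c y) ⟩
  1/ c * c * y     ≡⟨ sym (unit y) ⟩
  y                ∎
  where
  open ≡-Reasoning
  unit : ∀ z → z ≡ 1/ c * c * z
  unit z = trans (sym (ℚₚ.*-identityˡ z)) (cong (_* z) (sym (ℚₚ.*-inverseˡ c)))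

sq-positive : ∀ x .{{_ : Positive x}} → Positive (sq x)
sq-positive x = ℚₚ.pos*pos⇒pos x x

sq-nonZero : ∀ x .{{_ : Positive x}} → NonZero (sq x)
sq-nonZero x = ℚₚ.pos⇒nonZero (sq x) {{sq-positive x}}

sq-cong-* : ∀ d x n y → d * x ≡ n * y → sq d * sq x ≡ sq n * sq y
sq-cong-* d x n y eq = trans (regroup d x) (trans (cong sq eq) (sym (regroup n y)))
  where
  regroup : ∀ a b → a * a * (b * b) ≡ a * b * (a * b)
  regroup = solve-∀ ℚ-ring

-- If d₁ x₁ = n₁ x₀ with d₁ ≠ 0, then c₁ x₁ + c₀ x₀ = (c₁ n₁ + c₀ d₁) x₀ / d₁. Iterating
-- this along a chain of such first-order relations turns the vanishing of a linear form
-- in hypergeometric values into a polynomial identity in the coefficients.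
vanish₂ : ∀ x₁ x₀ d₁ n₁ c₁ c₀ .{{_ : NonZero d₁}} → d₁ * x₁ ≡ n₁ * x₀ →
          c₁ * n₁ + c₀ * d₁ ≡ 0ℚ → c₁ * x₁ + c₀ * x₀ ≡ 0ℚ
vanish₂ x₁ x₀ d₁ n₁ c₁ c₀ r₁ coefficients = *-cancelˡ-≡ d₁ (begin
  d₁ * (c₁ * x₁ + c₀ * x₀)       ≡⟨ expand d₁ n₁ c₁ c₀ x₁ x₀ ⟩
  c₁ * (d₁ * x₁ - n₁ * x₀) + (c₁ * n₁ + c₀ * d₁) * x₀
    ≡⟨ cong₂ (λ s t → c₁ * s + t * x₀) (difference-zero r₁) coefficients ⟩
  c₁ * 0ℚ + 0ℚ * x₀              ≡⟨ zeros c₁ x₀ d₁ ⟩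
  d₁ * 0ℚ                        ∎)
  where
  open ≡-Reasoning
  expand : ∀ d n c₁ c₀ x₁ x₀ →
    d * (c₁ * x₁ + c₀ * x₀) ≡ c₁ * (d * x₁ - n * x₀) + (c₁ * n + c₀ * d) * x₀
  expand = solve-∀ ℚ-ring
  difference-zero : ∀ {s t} → s ≡ t → s - t ≡ 0ℚ
  difference-zero {s} refl = ℚₚ.+-inverseʳ s
  zeros : ∀ c x d → c * 0ℚ + 0ℚ * x ≡ d * 0ℚ
  zeros = solve-∀ ℚ-ring

vanish₃ : ∀ x₂ x₁ x₀ d₂ n₂ d₁ n₁ c₂ c₁ c₀ .{{_ : NonZero d₁}} .{{_ : NonZero d₂}} →
          d₁ * x₁ ≡ n₁ * x₀ → d₂ * x₂ ≡ n₂ * x₁ →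
          (c₂ * n₂ + c₁ * d₂) * n₁ + c₀ * d₂ * d₁ ≡ 0ℚ →
          c₂ * x₂ + (c₁ * x₁ + c₀ * x₀) ≡ 0ℚ
vanish₃ x₂ x₁ x₀ d₂ n₂ d₁ n₁ c₂ c₁ c₀ r₁ r₂ coefficients = *-cancelˡ-≡ d₂ (begin
  d₂ * (c₂ * x₂ + (c₁ * x₁ + c₀ * x₀))
    ≡⟨ expand d₂ c₂ c₁ c₀ x₂ x₁ x₀ ⟩
  c₂ * (d₂ * x₂) + (c₁ * d₂ * x₁ + c₀ * d₂ * x₀)
    ≡⟨ cong (λ t → c₂ * t + (c₁ * d₂ * x₁ + c₀ * d₂ * x₀)) r₂ ⟩
  c₂ * (n₂ * x₁) + (c₁ * d₂ * x₁ + c₀ * d₂ * x₀)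
    ≡⟨ collect d₂ n₂ c₂ c₁ c₀ x₁ x₀ ⟩
  (c₂ * n₂ + c₁ * d₂) * x₁ + c₀ * d₂ * x₀
    ≡⟨ vanish₂ x₁ x₀ d₁ n₁ (c₂ * n₂ + c₁ * d₂) (c₀ * d₂) r₁ coefficients ⟩
  0ℚ
    ≡⟨ sym (ℚₚ.*-zeroʳ d₂) ⟩
  d₂ * 0ℚ ∎)
  where
  open ≡-Reasoning
  expand : ∀ d c₂ c₁ c₀ x₂ x₁ x₀ →
    d * (c₂ * x₂ + (c₁ * x₁ + c₀ * x₀)) ≡ c₂ * (d * x₂) + (c₁ * d * x₁ + c₀ * d * x₀)
  expand = solve-∀ ℚ-ring
  collect : ∀ d n c₂ c₁ c₀ x₁ x₀ →
    c₂ * (n * x₁) + (c₁ * d * x₁ + c₀ * d * x₀) ≡ (c₂ * n + c₁ * d) * x₁ + c₀ * d * x₀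
  collect = solve-∀ ℚ-ring

vanish₄ : ∀ x₃ x₂ x₁ x₀ d₃ n₃ d₂ n₂ d₁ n₁ c₃ c₂ c₁ c₀ →
          .{{_ : NonZero d₁}} .{{_ : NonZero d₂}} .{{_ : NonZero d₃}} →
          d₁ * x₁ ≡ n₁ * x₀ → d₂ * x₂ ≡ n₂ * x₁ → d₃ * x₃ ≡ n₃ * x₂ →
          ((c₃ * n₃ + c₂ * d₃) * n₂ + c₁ * d₃ * d₂) * n₁ + c₀ * d₃ * d₂ * d₁ ≡ 0ℚ →
          c₃ * x₃ + (c₂ * x₂ + (c₁ * x₁ + c₀ * x₀)) ≡ 0ℚ
vanish₄ x₃ x₂ x₁ x₀ d₃ n₃ d₂ n₂ d₁ n₁ c₃ c₂ c₁ c₀ r₁ r₂ r₃ coefficients = *-cancelˡ-≡ d₃ (begin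
  d₃ * (c₃ * x₃ + (c₂ * x₂ + (c₁ * x₁ + c₀ * x₀)))
    ≡⟨ expand d₃ c₃ c₂ c₁ c₀ x₃ x₂ x₁ x₀ ⟩
  c₃ * (d₃ * x₃) + (c₂ * d₃ * x₂ + (c₁ * d₃ * x₁ + c₀ * d₃ * x₀))
    ≡⟨ cong (λ t → c₃ * t + (c₂ * d₃ * x₂ + (c₁ * d₃ * x₁ + c₀ * d₃ * x₀))) r₃ ⟩
  c₃ * (n₃ * x₂) + (c₂ * d₃ * x₂ + (c₁ * d₃ * x₁ + c₀ * d₃ * x₀))
    ≡⟨ collect d₃ n₃ c₃ c₂ (c₁ * d₃ * x₁ + c₀ * d₃ * x₀) x₂ ⟩
  (c₃ * n₃ + c₂ * d₃) * x₂ + (c₁ * d₃ * x₁ + c₀ * d₃ * x₀)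
    ≡⟨ vanish₃ x₂ x₁ x₀ d₂ n₂ d₁ n₁ (c₃ * n₃ + c₂ * d₃) (c₁ * d₃) (c₀ * d₃) r₁ r₂ coefficients ⟩
  0ℚ
    ≡⟨ sym (ℚₚ.*-zeroʳ d₃) ⟩
  d₃ * 0ℚ ∎)
  where
  open ≡-Reasoning
  expand : ∀ d c₃ c₂ c₁ c₀ x₃ x₂ x₁ x₀ →
    d * (c₃ * x₃ + (c₂ * x₂ + (c₁ * x₁ + c₀ * x₀)))
      ≡ c₃ * (d * x₃) + (c₂ * d * x₂ + (c₁ * d * x₁ + c₀ * d * x₀))
  expand = solve-∀ ℚ-ring
  collect : ∀ d n c₃ c₂ r x → c₃ * (n * x) + (c₂ * d * x + r) ≡ (c₃ * n + c₂ * d) * x + r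
  collect = solve-∀ ℚ-ring

-- Creative telescoping along antidiagonals

sumTo-cong : ∀ n {f g : ℕ → ℚ} → (∀ k → k ≤ n → f k ≡ g k) → sumTo n f ≡ sumTo n g
sumTo-cong zero    eq = eq 0 ℕ.z≤n
sumTo-cong (suc n) eq =
  cong₂ _+_ (sumTo-cong n (λ k k≤n → eq k (ℕₚ.m≤n⇒m≤1+n k≤n))) (eq (suc n) ℕₚ.≤-refl)

sumTo-+ : ∀ n (f g : ℕ → ℚ) → sumTo n (λ k → f k + g k) ≡ sumTo n f + sumTo n g
sumTo-+ zero    f g = refl
sumTo-+ (suc n) f g =
  trans (cong (_+ (f (suc n) + g (suc n))) (sumTo-+ n f g)) (interchange (sumTo n f) (sumTo n g) (f (suc n)) (g (suc n)))
  where
  interchange : ∀ a b c d → a + b + (c + d) ≡ a + c + (b + d)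
  interchange = solve-∀ ℚ-ring

sumTo-* : ∀ n c (f : ℕ → ℚ) → sumTo n (λ k → c * f k) ≡ c * sumTo n f
sumTo-* zero    c f = refl
sumTo-* (suc n) c f =
  trans (cong (_+ c * f (suc n)) (sumTo-* n c f)) (sym (ℚₚ.*-distribˡ-+ c (sumTo n f) (f (suc n))))

sumTo-telescope : ∀ n (u : ℕ → ℚ) → sumTo n (λ k → u (suc k) - u k) ≡ u (suc n) - u 0
sumTo-telescope zero    u = refl
sumTo-telescope (suc n) u =
  trans (cong (_+ (u (2 ℕ.+ n) - u (suc n))) (sumTo-telescope n u)) (collapse (u 0) (u (suc n)) (u (2 ℕ.+ n)))
  where
  collapse : ∀ a b c → b - a + (c - b) ≡ c - a
  collapse = solve-∀ ℚ-ring

antidiagonalSum : (ℕ → ℕ → ℚ) → ℕ → ℚ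
antidiagonalSum f n = sumTo n (λ k → f k (n ∸ k))

antidiagonalSum-suc : ∀ (f : ℕ → ℕ → ℚ) n →
  antidiagonalSum f (suc n) ≡ antidiagonalSum (λ k j → f k (suc j)) n + f (suc n) 0
antidiagonalSum-suc f n =
  cong₂ _+_ (sumTo-cong n (λ k k≤n → cong (f k) (ℕₚ.+-∸-assoc 1 k≤n))) (cong (f (suc n)) (ℕₚ.n∸n≡0 n))

record SatisfiesRecurrence (p₂ p₁ p₀ u : ℕ → ℚ) : Set where
  constructor satisfiesRecurrence
  field
    recurrence : ∀ n → p₂ n * u (2 ℕ.+ n) + p₁ n * u (1 ℕ.+ n) + p₀ n * u n ≡ 0ℚ

open SatisfiesRecurrence

antidiagonalSum-telescope : ∀ (p₂ p₁ p₀ : ℕ → ℚ) (f g : ℕ → ℕ → ℚ) →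
  (∀ k j → p₂ (k ℕ.+ j) * f k (2 ℕ.+ j) + p₁ (k ℕ.+ j) * f k (1 ℕ.+ j) + p₀ (k ℕ.+ j) * f k j
             ≡ g (suc k) (suc j) - g k (2 ℕ.+ j)) →
  ∀ n → p₂ n * antidiagonalSum (λ k j → f k (2 ℕ.+ j)) n + p₁ n * antidiagonalSum (λ k j → f k (1 ℕ.+ j)) n
          + p₀ n * antidiagonalSum f n
        ≡ g (suc n) 1 - g 0 (2 ℕ.+ n)
antidiagonalSum-telescope p₂ p₁ p₀ f g interior n = begin
  p₂ n * sumTo n (λ k → f k (2 ℕ.+ (n ∸ k))) + p₁ n * sumTo n (λ k → f k (1 ℕ.+ (n ∸ k)))
    + p₀ n * sumTo n (λ k → f k (n ∸ k))
    ≡⟨ sym (cong₂ _+_ (cong₂ _+_ (sumTo-* n (p₂ n) _) (sumTo-* n (p₁ n) _)) (sumTo-* n (p₀ n) _)) ⟩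
  sumTo n (λ k → p₂ n * f k (2 ℕ.+ (n ∸ k))) + sumTo n (λ k → p₁ n * f k (1 ℕ.+ (n ∸ k)))
    + sumTo n (λ k → p₀ n * f k (n ∸ k))
    ≡⟨ sym (trans (sumTo-+ n _ _) (cong (_+ _) (sumTo-+ n _ _))) ⟩
  sumTo n (λ k → p₂ n * f k (2 ℕ.+ (n ∸ k)) + p₁ n * f k (1 ℕ.+ (n ∸ k)) + p₀ n * f k (n ∸ k))
    ≡⟨ sumTo-cong n termwise ⟩
  sumTo n (λ k → u (suc k) - u k)
    ≡⟨ sumTo-telescope n u ⟩
  g (suc n) (suc n ∸ n) - g 0 (2 ℕ.+ n)
    ≡⟨ cong (λ m → g (suc n) m - g 0 (2 ℕ.+ n)) (ℕₚ.m+n∸n≡m 1 n) ⟩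
  g (suc n) 1 - g 0 (2 ℕ.+ n) ∎
  where
  open ≡-Reasoning
  u : ℕ → ℚ
  u k = g k (2 ℕ.+ n ∸ k)
  termwise : ∀ k → k ≤ n →
    p₂ n * f k (2 ℕ.+ (n ∸ k)) + p₁ n * f k (1 ℕ.+ (n ∸ k)) + p₀ n * f k (n ∸ k) ≡ u (suc k) - u k
  termwise k k≤n = begin
    p₂ n * f k (2 ℕ.+ (n ∸ k)) + p₁ n * f k (1 ℕ.+ (n ∸ k)) + p₀ n * f k (n ∸ k)
      ≡⟨ cong (λ m → p₂ m * f k (2 ℕ.+ (n ∸ k)) + p₁ m * f k (1 ℕ.+ (n ∸ k)) + p₀ m * f k (n ∸ k))
              (sym (ℕₚ.m+[n∸m]≡n k≤n)) ⟩
    p₂ (k ℕ.+ (n ∸ k)) * f k (2 ℕ.+ (n ∸ k)) + p₁ (k ℕ.+ (n ∸ k)) * f k (1 ℕ.+ (n ∸ k))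
      + p₀ (k ℕ.+ (n ∸ k)) * f k (n ∸ k)
      ≡⟨ interior k (n ∸ k) ⟩
    g (suc k) (suc (n ∸ k)) - g k (2 ℕ.+ (n ∸ k))
      ≡⟨ cong₂ (λ a b → g (suc k) a - g k b) (sym (ℕₚ.+-∸-assoc 1 k≤n)) (sym (ℕₚ.+-∸-assoc 2 k≤n)) ⟩
    u (suc k) - u k ∎

-- g is the certificate; the last hypothesis is the telescoping relation at j = -1 and
-- j = -2 for f extended by zero.
antidiagonalSum-recurrence : ∀ (p₂ p₁ p₀ : ℕ → ℚ) (f g : ℕ → ℕ → ℚ) →
  (∀ k j → p₂ (k ℕ.+ j) * f k (2 ℕ.+ j) + p₁ (k ℕ.+ j) * f k (1 ℕ.+ j) + p₀ (k ℕ.+ j) * f k j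
             ≡ g (suc k) (suc j) - g k (2 ℕ.+ j)) →
  (∀ m → g 0 m ≡ 0ℚ) →
  (∀ n → g (suc n) 1 + p₂ n * (f (suc n) 1 + f (2 ℕ.+ n) 0) + p₁ n * f (suc n) 0 ≡ 0ℚ) →
  SatisfiesRecurrence p₂ p₁ p₀ (antidiagonalSum f)
antidiagonalSum-recurrence p₂ p₁ p₀ f g interior g₀ boundary = satisfiesRecurrence step
  where
  step : ∀ n →
    p₂ n * antidiagonalSum f (2 ℕ.+ n) + p₁ n * antidiagonalSum f (1 ℕ.+ n) + p₀ n * antidiagonalSum f n ≡ 0ℚ
  step n = begin
    p₂ n * S (2 ℕ.+ n) + p₁ n * S (1 ℕ.+ n) + p₀ n * S n
      ≡⟨ cong₂ (λ a b → p₂ n * a + p₁ n * b + p₀ n * S n) S₂ (antidiagonalSum-suc f n) ⟩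
    p₂ n * (T₂ + F₁ + F₂) + p₁ n * (T₁ + F₀) + p₀ n * S n
      ≡⟨ regroup (p₂ n) (p₁ n) (p₀ n) T₂ T₁ (S n) F₁ F₂ F₀ ⟩
    (p₂ n * T₂ + p₁ n * T₁ + p₀ n * S n) + (p₂ n * (F₁ + F₂) + p₁ n * F₀)
      ≡⟨ cong (_+ (p₂ n * (F₁ + F₂) + p₁ n * F₀)) interiorSum ⟩
    (g (suc n) 1 - 0ℚ) + (p₂ n * (F₁ + F₂) + p₁ n * F₀)
      ≡⟨ reassociate (g (suc n) 1) (p₂ n * (F₁ + F₂)) (p₁ n * F₀) ⟩
    g (suc n) 1 + p₂ n * (F₁ + F₂) + p₁ n * F₀
      ≡⟨ boundary n ⟩
    0ℚ ∎
    where
    open ≡-Reasoning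
    S = antidiagonalSum f
    T₂ = antidiagonalSum (λ k j → f k (2 ℕ.+ j)) n
    T₁ = antidiagonalSum (λ k j → f k (1 ℕ.+ j)) n
    F₀ = f (suc n) 0
    F₁ = f (suc n) 1
    F₂ = f (2 ℕ.+ n) 0
    S₂ : S (2 ℕ.+ n) ≡ T₂ + F₁ + F₂
    S₂ = trans (antidiagonalSum-suc f (suc n)) (cong (_+ F₂) (antidiagonalSum-suc (λ k j → f k (suc j)) n))
    regroup : ∀ a b c x y z u v w →
      a * (x + u + v) + b * (y + w) + c * z ≡ (a * x + b * y + c * z) + (a * (u + v) + b * w)
    regroup = solve-∀ ℚ-ring
    reassociate : ∀ g a b → (g - 0ℚ) + (a + b) ≡ g + a + b
    reassociate = solve-∀ ℚ-ring
    interiorSum : p₂ n * T₂ + p₁ n * T₁ + p₀ n * S n ≡ g (suc n) 1 - 0ℚ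
    interiorSum = trans (antidiagonalSum-telescope p₂ p₁ p₀ f g interior n)
                        (cong (λ z → g (suc n) 1 - z) (g₀ (2 ℕ.+ n)))

SatisfiesRecurrence-unique : ∀ {p₂ p₁ p₀ u w : ℕ → ℚ} → (∀ n → NonZero (p₂ n)) →
  SatisfiesRecurrence p₂ p₁ p₀ u → SatisfiesRecurrence p₂ p₁ p₀ w →
  u 0 ≡ w 0 → u 1 ≡ w 1 → ∀ n → u n ≡ w n
SatisfiesRecurrence-unique {p₂} {p₁} {p₀} {u} {w} p₂≢0 rec-u rec-w u₀≡w₀ u₁≡w₁ n = proj₁ (agree n)
  where
  sameRest : ∀ x y a b → x + a + b ≡ 0ℚ → y + a + b ≡ 0ℚ → x ≡ y
  sameRest x y a b eqx eqy = begin
    x                       ≡⟨ isolate x a b ⟩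
    x + a + b - (a + b)     ≡⟨ cong (_- (a + b)) (trans eqx (sym eqy)) ⟩
    y + a + b - (a + b)     ≡⟨ sym (isolate y a b) ⟩
    y                       ∎
    where
    open ≡-Reasoning
    isolate : ∀ x a b → x ≡ x + a + b - (a + b)
    isolate = solve-∀ ℚ-ring
  agree : ∀ n → u n ≡ w n × u (suc n) ≡ w (suc n)
  agree zero = u₀≡w₀ , u₁≡w₁
  agree (suc n) with agree n
  ... | uₙ≡wₙ , uₙ₊₁≡wₙ₊₁ = uₙ₊₁≡wₙ₊₁ , *-cancelˡ-≡ (p₂ n) {{p₂≢0 n}}
    (sameRest (p₂ n * u (2 ℕ.+ n)) (p₂ n * w (2 ℕ.+ n)) (p₁ n * u (1 ℕ.+ n)) (p₀ n * u n) (recurrence rec-u n)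
      (subst₂ (λ a b → p₂ n * w (2 ℕ.+ n) + p₁ n * a + p₀ n * b ≡ 0ℚ) (sym uₙ₊₁≡wₙ₊₁) (sym uₙ≡wₙ)
              (recurrence rec-w n)))

SatisfiesRecurrence-twist : ∀ (c : ℚ) {p₂ p₁ p₀ u : ℕ → ℚ} → SatisfiesRecurrence p₂ p₁ p₀ u →
  SatisfiesRecurrence p₂ (λ n → c * p₁ n) (λ n → c * (c * p₀ n)) (λ n → (c ^ℚ n) * u n)
SatisfiesRecurrence-twist c {p₂} {p₁} {p₀} {u} rec = satisfiesRecurrence λ n → twisted n
  where
  factor : ∀ c cⁿ a b d x y z →
    a * (c * (c * cⁿ) * x) + c * b * (c * cⁿ * y) + c * (c * d) * (cⁿ * z) ≡ c * c * cⁿ * (a * x + b * y + d * z)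
  factor = solve-∀ ℚ-ring
  twisted : ∀ n → p₂ n * (c ^ℚ (2 ℕ.+ n) * u (2 ℕ.+ n)) + c * p₁ n * (c ^ℚ (1 ℕ.+ n) * u (1 ℕ.+ n))
                    + c * (c * p₀ n) * (c ^ℚ n * u n) ≡ 0ℚ
  twisted n = begin
    p₂ n * (c * (c * cⁿ) * u (2 ℕ.+ n)) + c * p₁ n * (c * cⁿ * u (1 ℕ.+ n)) + c * (c * p₀ n) * (cⁿ * u n)
      ≡⟨ factor c cⁿ (p₂ n) (p₁ n) (p₀ n) (u (2 ℕ.+ n)) (u (1 ℕ.+ n)) (u n) ⟩
    c * c * cⁿ * (p₂ n * u (2 ℕ.+ n) + p₁ n * u (1 ℕ.+ n) + p₀ n * u n)
      ≡⟨ cong (c * c * cⁿ *_) (recurrence rec n) ⟩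
    c * c * cⁿ * 0ℚ
      ≡⟨ ℚₚ.*-zeroʳ (c * c * cⁿ) ⟩
    0ℚ ∎
    where
    open ≡-Reasoning
    cⁿ = c ^ℚ n

pochRatio : ℚ → ℕ → ℚ
pochRatio c k = poch c k ÷poch1 k

÷-cancel : ∀ x y .{{_ : NonZero y}} → y * (x ÷ y) ≡ x
÷-cancel x y = begin
  y * (x * 1/ y)   ≡⟨ swap y x (1/ y) ⟩
  x * (y * 1/ y)   ≡⟨ cong (x *_) (ℚₚ.*-inverseʳ y) ⟩
  x * 1ℚ           ≡⟨ ℚₚ.*-identityʳ x ⟩
  x                ∎
  where
  open ≡-Reasoning
  swap : ∀ a b c → a * (b * c) ≡ b * (a * c)
  swap = solve-∀ ℚ-ring

pochRatio-suc : ∀ c k → (ι k + 1ℚ) * pochRatio c (suc k) ≡ (c + ι k) * pochRatio c k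
pochRatio-suc c k = *-cancelˡ-≡ D {{poch1-nonZero (suc k)}} (begin
  D * ((ι k + 1ℚ) * pochRatio c (suc k))
    ≡⟨ swap D (ι k + 1ℚ) (pochRatio c (suc k)) ⟩
  (ι k + 1ℚ) * (D * pochRatio c (suc k))
    ≡⟨ cong ((ι k + 1ℚ) *_) (÷-cancel (poch c (suc k)) D {{poch1-nonZero (suc k)}}) ⟩
  (ι k + 1ℚ) * (poch c k * (c + ℕ→ℚ k))
    ≡⟨ cong (λ s → (ι k + 1ℚ) * (poch c k * (c + s))) (ℕ→ℚ≡ι k) ⟩
  (ι k + 1ℚ) * (poch c k * (c + ι k))
    ≡⟨ regroup (ι k) c (poch c k) ⟩
  (1ℚ + ι k) * (c + ι k) * poch c k
    ≡⟨ cong ((1ℚ + ι k) * (c + ι k) *_) (sym (÷-cancel (poch c k) F {{poch1-nonZero k}})) ⟩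
  (1ℚ + ι k) * (c + ι k) * (F * pochRatio c k)
    ≡⟨ rotate (1ℚ + ι k) (c + ι k) F (pochRatio c k) ⟩
  F * (1ℚ + ι k) * ((c + ι k) * pochRatio c k)
    ≡⟨ cong (λ s → F * (1ℚ + s) * ((c + ι k) * pochRatio c k)) (sym (ℕ→ℚ≡ι k)) ⟩
  D * ((c + ι k) * pochRatio c k) ∎)
  where
  open ≡-Reasoning
  F = poch 1ℚ k
  D = poch 1ℚ (suc k)
  swap : ∀ a b c → a * (b * c) ≡ b * (a * c)
  swap = solve-∀ ℚ-ring
  rotate : ∀ a b f r → a * b * (f * r) ≡ f * a * (b * r)
  rotate = solve-∀ ℚ-ring
  regroup : ∀ K c p → (K + 1ℚ) * (p * (c + K)) ≡ (1ℚ + K) * (c + K) * p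
  regroup = solve-∀ ℚ-ring

pochRatio-lower : ∀ c k → c * pochRatio (c + 1ℚ) k ≡ (c + ι k) * pochRatio c k
pochRatio-lower c zero    = shift c
  where
  shift : ∀ c → c * 1ℚ ≡ (c + 0ℚ) * 1ℚ
  shift = solve-∀ ℚ-ring
pochRatio-lower c (suc k) = *-cancelˡ-≡ (ι k + 1ℚ) {{ι-suc-nonZero k}} (begin
  (ι k + 1ℚ) * (c * pochRatio (c + 1ℚ) (suc k))  ≡⟨ swap (ι k + 1ℚ) c (pochRatio (c + 1ℚ) (suc k)) ⟩
  c * ((ι k + 1ℚ) * pochRatio (c + 1ℚ) (suc k))  ≡⟨ cong (c *_) (pochRatio-suc (c + 1ℚ) k) ⟩
  c * ((c + 1ℚ + ι k) * pochRatio (c + 1ℚ) k)    ≡⟨ swap c (c + 1ℚ + ι k) (pochRatio (c + 1ℚ) k) ⟩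
  (c + 1ℚ + ι k) * (c * pochRatio (c + 1ℚ) k)    ≡⟨ cong ((c + 1ℚ + ι k) *_) (pochRatio-lower c k) ⟩
  (c + 1ℚ + ι k) * ((c + ι k) * r)               ≡⟨ reassociate c (ι k) ((c + ι k) * r) ⟩
  (c + (ι k + 1ℚ)) * ((c + ι k) * r)             ≡⟨ cong ((c + (ι k + 1ℚ)) *_) (sym (pochRatio-suc c k)) ⟩
  (c + (ι k + 1ℚ)) * ((ι k + 1ℚ) * r₁)           ≡⟨ swap (c + (ι k + 1ℚ)) (ι k + 1ℚ) r₁ ⟩
  (ι k + 1ℚ) * ((c + (ι k + 1ℚ)) * r₁)           ∎)
  where
  open ≡-Reasoning
  r = pochRatio c k
  r₁ = pochRatio c (suc k)
  swap : ∀ a b c → a * (b * c) ≡ b * (a * c)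
  swap = solve-∀ ℚ-ring
  reassociate : ∀ c K x → (c + 1ℚ + K) * x ≡ (c + (K + 1ℚ)) * x
  reassociate = solve-∀ ℚ-ring

-- The left-hand side

α β v : ℕ → ℚ
α = pochRatio (+ 1 / 3)
β = pochRatio (+ 2 / 3)
v = pochRatio (- (+ 1 / 3))

α-suc : ∀ k → (ι k + 1ℚ) * α (suc k) ≡ (+ 1 / 3 + ι k) * α k
α-suc = pochRatio-suc (+ 1 / 3)

v-suc : ∀ j → (ι j + 1ℚ) * v (suc j) ≡ (- (+ 1 / 3) + ι j) * v j
v-suc = pochRatio-suc (- (+ 1 / 3))

β≡v : ∀ j → β j ≡ (1ℚ - + 3 / 1 * ι j) * v j
β≡v j = begin
  β j                                     ≡⟨ unthird (β j) ⟩
  - (+ 3 / 1) * (- (+ 1 / 3) * β j)       ≡⟨ cong (- (+ 3 / 1) *_) (pochRatio-lower (- (+ 1 / 3)) j) ⟩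
  - (+ 3 / 1) * ((- (+ 1 / 3) + ι j) * v j) ≡⟨ expand (ι j) (v j) ⟩
  (1ℚ - + 3 / 1 * ι j) * v j              ∎
  where
  open ≡-Reasoning
  unthird : ∀ b → b ≡ - (+ 3 / 1) * (- (+ 1 / 3) * b)
  unthird = solve-∀ ℚ-ring
  expand : ∀ J x → - (+ 3 / 1) * ((- (+ 1 / 3) + J) * x) ≡ (1ℚ - + 3 / 1 * J) * x
  expand = solve-∀ ℚ-ring

termL : ℕ → ℕ → ℚ
termL k j = sq (α k * β j)

lhsTerm≡termL : ∀ n k → lhsTerm n k ≡ termL k (n ∸ k)
lhsTerm≡termL n k = cong sq (regroup (poch (+ 1 / 3) k) (poch (+ 2 / 3) (n ∸ k))
                                     ((1/ poch 1ℚ k) {{poch1-nonZero k}}) ((1/ poch 1ℚ (n ∸ k)) {{poch1-nonZero (n ∸ k)}}))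
  where
  regroup : ∀ a b f g → a * b * f * g ≡ a * f * (b * g)
  regroup = solve-∀ ℚ-ring

qL₂ qL₁ qL₀ : ℚ → ℚ
qL₂ N = (N + + 2 / 1) * (N + + 2 / 1) * (N + + 2 / 1)
qL₁ N = - (+ 1 / 27) * (+ 2 / 1 * N + + 3 / 1) * (+ 27 / 1 * N * N + + 81 / 1 * N + + 69 / 1)
qL₀ N = (N + 1ℚ) * (N + 1ℚ) * (N + 1ℚ)

QL : ℚ → ℚ → ℚ
QL K M = + 3 / 1 * M * M + + 6 / 1 * K * M - + 3 / 1 * M - K

-- The creative-telescoping certificate of termL, as found by Zeilberger's algorithm.
certL : ℕ → ℕ → ℚ
certL k m = QL (ι k) (ι m) * sq (ι k * α k * v m)

cL₂ cL₁ cL₀ : ℚ → ℚ → ℚ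
cL₂ K J = qL₂ (K + J) * sq (1ℚ - + 3 / 1 * (J + 1ℚ + 1ℚ)) + sq K * QL K (J + 1ℚ + 1ℚ)
cL₁ K J = qL₁ (K + J) * sq (1ℚ - + 3 / 1 * (J + 1ℚ)) - sq (+ 1 / 3 + K) * QL (K + 1ℚ) (J + 1ℚ)
cL₀ K J = qL₀ (K + J) * sq (1ℚ - + 3 / 1 * J)

cL-boundary : ℚ → ℚ
cL-boundary N = QL (N + 1ℚ) (0ℚ + 1ℚ) * sq ((N + 1ℚ) * - (+ 1 / 3)) + qL₂ N * sq (+ 2 / 3) + qL₁ N

-- The interior and boundary telescoping relations of termL, divided by α_k² v_j² and α_{n+1}²
-- respectively, after eliminating the other values through their first-order recurrences.
polynomialIdentitiesL :
  let sq : ℚ → ℚ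
      sq x = x * x
      qL₂ : ℚ → ℚ
      qL₂ N = (N + + 2 / 1) * (N + + 2 / 1) * (N + + 2 / 1)
      qL₁ : ℚ → ℚ
      qL₁ N = - (+ 1 / 27) * (+ 2 / 1 * N + + 3 / 1) * (+ 27 / 1 * N * N + + 81 / 1 * N + + 69 / 1)
      qL₀ : ℚ → ℚ
      qL₀ N = (N + 1ℚ) * (N + 1ℚ) * (N + 1ℚ)
      QL : ℚ → ℚ → ℚ
      QL K M = + 3 / 1 * M * M + + 6 / 1 * K * M - + 3 / 1 * M - K
      cL₂ : ℚ → ℚ → ℚ
      cL₂ K J = qL₂ (K + J) * sq (1ℚ - + 3 / 1 * (J + 1ℚ + 1ℚ)) + sq K * QL K (J + 1ℚ + 1ℚ)
      cL₁ : ℚ → ℚ → ℚ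
      cL₁ K J = qL₁ (K + J) * sq (1ℚ - + 3 / 1 * (J + 1ℚ)) - sq (+ 1 / 3 + K) * QL (K + 1ℚ) (J + 1ℚ)
      cL₀ : ℚ → ℚ → ℚ
      cL₀ K J = qL₀ (K + J) * sq (1ℚ - + 3 / 1 * J)
      cL-boundary : ℚ → ℚ
      cL-boundary N = QL (N + 1ℚ) (0ℚ + 1ℚ) * sq ((N + 1ℚ) * - (+ 1 / 3)) + qL₂ N * sq (+ 2 / 3) + qL₁ N
  in (∀ K J → (cL₂ K J * sq (- (+ 1 / 3) + (J + 1ℚ)) + cL₁ K J * sq (J + 1ℚ + 1ℚ)) * sq (- (+ 1 / 3) + J)
                + cL₀ K J * sq (J + 1ℚ + 1ℚ) * sq (J + 1ℚ) ≡ 0ℚ)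
     × (∀ N → qL₂ N * sq (+ 1 / 3 + (N + 1ℚ)) + cL-boundary N * sq (N + 1ℚ + 1ℚ) ≡ 0ℚ)
polynomialIdentitiesL = solve-∀ ℚ-ring , solve-∀ ℚ-ring

interiorL : ∀ k j →
  qL₂ (ι (k ℕ.+ j)) * termL k (2 ℕ.+ j) + qL₁ (ι (k ℕ.+ j)) * termL k (1 ℕ.+ j) + qL₀ (ι (k ℕ.+ j)) * termL k j
    ≡ certL (suc k) (suc j) - certL k (2 ℕ.+ j)
interiorL k j = begin
  shape (ι (k ℕ.+ j)) (β (2 ℕ.+ j)) (β (1 ℕ.+ j)) (β j)
    ≡⟨ substitute (ι-+ k j) (β≡v (2 ℕ.+ j)) (β≡v (1 ℕ.+ j)) (β≡v j) ⟩
  shape (K + J) ((1ℚ - + 3 / 1 * (J + 1ℚ + 1ℚ)) * v₂) ((1ℚ - + 3 / 1 * (J + 1ℚ)) * v₁) ((1ℚ - + 3 / 1 * J) * v₀)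
    ≡⟨ expand K J a v₀ v₁ v₂ (qL₂ (K + J)) (qL₁ (K + J)) (qL₀ (K + J))
              (QL (K + 1ℚ) (J + 1ℚ)) (QL K (J + 1ℚ + 1ℚ)) ⟩
  R + sq a * (cL₂ K J * sq v₂ + (cL₁ K J * sq v₁ + cL₀ K J * sq v₀))
    ≡⟨ cong (λ t → R + sq a * t) vanishing ⟩
  R + sq a * 0ℚ
    ≡⟨ trans (cong (λ t → R + t) (ℚₚ.*-zeroʳ (sq a))) (ℚₚ.+-identityʳ R) ⟩
  R
    ≡⟨ cong (λ t → QL (K + 1ℚ) (J + 1ℚ) * sq (t * v₁) - QL K (J + 1ℚ + 1ℚ) * sq (K * a * v₂)) (sym (α-suc k)) ⟩
  certL (suc k) (suc j) - certL k (2 ℕ.+ j) ∎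
  where
  open ≡-Reasoning
  K = ι k
  J = ι j
  a = α k
  v₀ = v j
  v₁ = v (1 ℕ.+ j)
  v₂ = v (2 ℕ.+ j)
  R = QL (K + 1ℚ) (J + 1ℚ) * sq ((+ 1 / 3 + K) * a * v₁) - QL K (J + 1ℚ + 1ℚ) * sq (K * a * v₂)
  shape : ℚ → ℚ → ℚ → ℚ → ℚ
  shape N b₂ b₁ b₀ = qL₂ N * sq (a * b₂) + qL₁ N * sq (a * b₁) + qL₀ N * sq (a * b₀)
  substitute : ∀ {N b₂ b₁ b₀ N′ b₂′ b₁′ b₀′} → N ≡ N′ → b₂ ≡ b₂′ → b₁ ≡ b₁′ → b₀ ≡ b₀′ →
               shape N b₂ b₁ b₀ ≡ shape N′ b₂′ b₁′ b₀′
  substitute refl refl refl refl = refl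
  expand : ∀ K J a v₀ v₁ v₂ q₂ q₁ q₀ Q₁ Q₂ →
    let sq : ℚ → ℚ
        sq x = x * x
    in q₂ * sq (a * ((1ℚ - + 3 / 1 * (J + 1ℚ + 1ℚ)) * v₂)) + q₁ * sq (a * ((1ℚ - + 3 / 1 * (J + 1ℚ)) * v₁))
         + q₀ * sq (a * ((1ℚ - + 3 / 1 * J) * v₀))
       ≡ Q₁ * sq ((+ 1 / 3 + K) * a * v₁) - Q₂ * sq (K * a * v₂)
         + sq a * ((q₂ * sq (1ℚ - + 3 / 1 * (J + 1ℚ + 1ℚ)) + sq K * Q₂) * sq v₂
                   + ((q₁ * sq (1ℚ - + 3 / 1 * (J + 1ℚ)) - sq (+ 1 / 3 + K) * Q₁) * sq v₁
                      + q₀ * sq (1ℚ - + 3 / 1 * J) * sq v₀))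
  expand = solve-∀ ℚ-ring
  vanishing : cL₂ K J * sq v₂ + (cL₁ K J * sq v₁ + cL₀ K J * sq v₀) ≡ 0ℚ
  vanishing = vanish₃ (sq v₂) (sq v₁) (sq v₀)
    (sq (J + 1ℚ + 1ℚ)) (sq (- (+ 1 / 3) + (J + 1ℚ))) (sq (J + 1ℚ)) (sq (- (+ 1 / 3) + J))
    (cL₂ K J) (cL₁ K J) (cL₀ K J)
    {{sq-nonZero (J + 1ℚ) {{ι-suc-positive j}}}} {{sq-nonZero (J + 1ℚ + 1ℚ) {{ι-suc-positive (suc j)}}}}
    (sq-cong-* (J + 1ℚ) v₁ (- (+ 1 / 3) + J) v₀ (v-suc j))
    (sq-cong-* (J + 1ℚ + 1ℚ) v₂ (- (+ 1 / 3) + (J + 1ℚ)) v₁ (v-suc (suc j)))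
    (proj₁ polynomialIdentitiesL K J)

boundaryL : ∀ n →
  certL (suc n) 1 + qL₂ (ι n) * (termL (suc n) 1 + termL (2 ℕ.+ n) 0) + qL₁ (ι n) * termL (suc n) 0 ≡ 0ℚ
boundaryL n = trans (expand N a₀ a₁ (qL₂ N) (qL₁ N) (QL (N + 1ℚ) (0ℚ + 1ℚ)))
  (vanish₂ (sq a₁) (sq a₀) (sq (N + 1ℚ + 1ℚ)) (sq (+ 1 / 3 + (N + 1ℚ))) (qL₂ N) (cL-boundary N)
    {{sq-nonZero (N + 1ℚ + 1ℚ) {{ι-suc-positive (suc n)}}}}
    (sq-cong-* (N + 1ℚ + 1ℚ) a₁ (+ 1 / 3 + (N + 1ℚ)) a₀ (α-suc (suc n)))
    (proj₂ polynomialIdentitiesL N))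
  where
  N = ι n
  a₀ = α (suc n)
  a₁ = α (2 ℕ.+ n)
  expand : ∀ N a₀ a₁ q₂ q₁ Q →
    let sq : ℚ → ℚ
        sq x = x * x
    in Q * sq ((N + 1ℚ) * a₀ * - (+ 1 / 3)) + q₂ * (sq (a₀ * (+ 2 / 3)) + sq (a₁ * 1ℚ)) + q₁ * sq (a₀ * 1ℚ)
       ≡ q₂ * sq a₁ + (Q * sq ((N + 1ℚ) * - (+ 1 / 3)) + q₂ * sq (+ 2 / 3) + q₁) * sq a₀
  expand = solve-∀ ℚ-ring

certL-zero : ∀ m → certL 0 m ≡ 0ℚ
certL-zero m = vanishes (QL 0ℚ (ι m)) (α 0) (v m)
  where
  vanishes : ∀ q a w → q * (0ℚ * a * w * (0ℚ * a * w)) ≡ 0ℚ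
  vanishes = solve-∀ ℚ-ring

termL-recurrence : SatisfiesRecurrence (qL₂ ∘ ι) (qL₁ ∘ ι) (qL₀ ∘ ι) (antidiagonalSum termL)
termL-recurrence =
  antidiagonalSum-recurrence (qL₂ ∘ ι) (qL₁ ∘ ι) (qL₀ ∘ ι) termL certL interiorL certL-zero boundaryL

-- The right-hand side

termR : ℕ → ℕ → ℚ
termR k j = ι (weightR k) * ι ((j ℕ.+ 2 ℕ.* k) C j) * (m27 ^ℚ j)

absorbFactor : ℚ → ℚ → ℚ
absorbFactor J K = m27 * (J + + 2 / 1 * K + 1ℚ)

shiftFactor : ℚ → ℚ → ℚ
shiftFactor T U = + 3 / 1 * ((T + 1ℚ + 1ℚ) * (T + 1ℚ)) * ((U + 1ℚ + 1ℚ) * (U + 1ℚ))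

termR-suc : ∀ k j → (ι j + 1ℚ) * termR k (suc j) ≡ absorbFactor (ι j) (ι k) * termR k j
termR-suc k j = begin
  (ι j + 1ℚ) * (w * C₁ * (m27 * p))        ≡⟨ regroup (ι j + 1ℚ) w C₁ p ⟩
  m27 * w * ((ι j + 1ℚ) * C₁) * p          ≡⟨ cong (λ t → m27 * w * t * p) absorb ⟩
  m27 * w * ((U + 1ℚ) * C₀) * p            ≡⟨ cong (λ u → m27 * w * ((u + 1ℚ) * C₀) * p) (ι-+2* j k) ⟩
  m27 * w * ((ι j + + 2 / 1 * ι k + 1ℚ) * C₀) * p
                                           ≡⟨ regroup′ (ι j + + 2 / 1 * ι k + 1ℚ) w C₀ p ⟩
  absorbFactor (ι j) (ι k) * (w * C₀ * p)  ∎
  where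
  open ≡-Reasoning
  w = ι (weightR k)
  p = m27 ^ℚ j
  U = ι (j ℕ.+ 2 ℕ.* k)
  C₁ = ι ((suc j ℕ.+ 2 ℕ.* k) C suc j)
  C₀ = ι ((j ℕ.+ 2 ℕ.* k) C j)
  absorb : (ι j + 1ℚ) * C₁ ≡ (U + 1ℚ) * C₀
  absorb = ι-cast (suc j) _ (suc (j ℕ.+ 2 ℕ.* k)) _ (C-absorb j (2 ℕ.* k))
  regroup : ∀ d w c p → d * (w * c * (m27 * p)) ≡ m27 * w * (d * c) * p
  regroup = solve-∀ ℚ-ring
  regroup′ : ∀ u w c p → m27 * w * (u * c) * p ≡ m27 * u * (w * c * p)
  regroup′ = solve-∀ ℚ-ring

termR-one : ∀ k → termR k 1 ≡ absorbFactor 0ℚ (ι k) * termR k 0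
termR-one k = trans (one-* (termR k 1)) (termR-suc k 0)
  where
  one-* : ∀ x → x ≡ (0ℚ + 1ℚ) * x
  one-* = solve-∀ ℚ-ring

termR-shift : ∀ k m →
  sq (sq (ι k + 1ℚ)) * termR (suc k) m ≡ shiftFactor (+ 3 / 1 * ι k) (ι m + + 2 / 1 * ι k) * termR k m
termR-shift k m = begin
  sq (sq (ι k + 1ℚ)) * (ι w′ * ι C′ * p)
    ≡⟨ regroup (sq (sq (ι k + 1ℚ))) (ι w′ * ι C′) p ⟩
  sq (sq (ι k + 1ℚ)) * (ι w′ * ι C′) * p
    ≡⟨ cong₂ (λ s t → s * t * p) (sym (ι-*-* (suc k) (suc k) (suc k) (suc k))) (sym (ι-* w′ C′)) ⟩
  ι (s ℕ.* s ℕ.* (s ℕ.* s)) * ι (w′ ℕ.* C′) * p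
    ≡⟨ cong (_* p) (ι-cast (s ℕ.* s ℕ.* (s ℕ.* s)) (w′ ℕ.* C′) (3 ℕ.* (A ℕ.* B) ℕ.* (D ℕ.* E)) (w ℕ.* C₀)
                           (weightR-shift k m)) ⟩
  ι (3 ℕ.* (A ℕ.* B) ℕ.* (D ℕ.* E)) * ι (w ℕ.* C₀) * p
    ≡⟨ cong₂ (λ s t → s * t * p) (ι-*-* 3 (A ℕ.* B) D E) (ι-* w C₀) ⟩
  ι 3 * ι (A ℕ.* B) * (ι D * ι E) * (ι w * ι C₀) * p
    ≡⟨ cong (λ t → ι 3 * t * (ι D * ι E) * (ι w * ι C₀) * p) (ι-* A B) ⟩
  shiftFactor (ι (3 ℕ.* k)) (ι (m ℕ.+ 2 ℕ.* k)) * (ι w * ι C₀) * p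
    ≡⟨ cong₂ (λ t u → shiftFactor t u * (ι w * ι C₀) * p) (ι-* 3 k) (ι-+2* m k) ⟩
  shiftFactor (+ 3 / 1 * ι k) (ι m + + 2 / 1 * ι k) * (ι w * ι C₀) * p
    ≡⟨ sym (regroup (shiftFactor (+ 3 / 1 * ι k) (ι m + + 2 / 1 * ι k)) (ι w * ι C₀) p) ⟩
  shiftFactor (+ 3 / 1 * ι k) (ι m + + 2 / 1 * ι k) * (ι w * ι C₀ * p) ∎
  where
  open ≡-Reasoning
  s = suc k
  p = m27 ^ℚ m
  w′ = weightR (suc k)
  C′ = (m ℕ.+ 2 ℕ.* suc k) C m
  w = weightR k
  C₀ = (m ℕ.+ 2 ℕ.* k) C m
  A = suc (suc (3 ℕ.* k))
  B = suc (3 ℕ.* k)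
  D = suc (suc (m ℕ.+ 2 ℕ.* k))
  E = suc (m ℕ.+ 2 ℕ.* k)
  regroup : ∀ a x p → a * (x * p) ≡ a * x * p
  regroup = solve-∀ ℚ-ring

shiftFactor-nonZero : ∀ k m → NonZero (shiftFactor (+ 3 / 1 * ι k) (ι m + + 2 / 1 * ι k))
shiftFactor-nonZero k m =
  subst NonZero (cong₂ shiftFactor (ι-* 3 k) (ι-+2* m k)) (ℚₚ.pos⇒nonZero (shiftFactor T U) {{positive}})
  where
  T = ι (3 ℕ.* k)
  U = ι (m ℕ.+ 2 ℕ.* k)
  product : ∀ x y → Positive x → Positive y → Positive (x * y)
  product x y px py = ℚₚ.pos*pos⇒pos x {{px}} y {{py}}
  positive : Positive (shiftFactor T U)
  positive =
    product (+ 3 / 1 * ((T + 1ℚ + 1ℚ) * (T + 1ℚ))) ((U + 1ℚ + 1ℚ) * (U + 1ℚ))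
      (product (+ 3 / 1) ((T + 1ℚ + 1ℚ) * (T + 1ℚ)) _
        (product (T + 1ℚ + 1ℚ) (T + 1ℚ) (ι-suc-positive (suc (3 ℕ.* k))) (ι-suc-positive (3 ℕ.* k))))
      (product (U + 1ℚ + 1ℚ) (U + 1ℚ) (ι-suc-positive (suc (m ℕ.+ 2 ℕ.* k))) (ι-suc-positive (m ℕ.+ 2 ℕ.* k)))

pR₁ pR₀ : ℚ → ℚ
pR₁ N = m27 * qL₁ N
pR₀ N = m27 * (m27 * qL₀ N)

PR : ℚ → ℚ → ℚ
PR K M = - (+ 6 / 1) * (+ 2 / 1 * K + + 2 / 1 * M - 1ℚ) * (+ 3 / 1 * K - 1ℚ) * (+ 3 / 1 * K - + 2 / 1)

-- The creative-telescoping certificate of termR, as found by Zeilberger's algorithm.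
certR : ℕ → ℕ → ℚ
certR zero    m = 0ℚ
certR (suc k) m = PR (ι k + 1ℚ) (ι m) * termR k m

-- Likewise for termR: the interior relations at k = 0 and at k + 1 and the boundary relation,
-- divided by termR 0 j, termR (k + 1) j and termR n 0.
polynomialIdentitiesR :
  let sq : ℚ → ℚ
      sq x = x * x
      qL₂ : ℚ → ℚ
      qL₂ N = (N + + 2 / 1) * (N + + 2 / 1) * (N + + 2 / 1)
      qL₁ : ℚ → ℚ
      qL₁ N = - (+ 1 / 27) * (+ 2 / 1 * N + + 3 / 1) * (+ 27 / 1 * N * N + + 81 / 1 * N + + 69 / 1)
      qL₀ : ℚ → ℚ
      qL₀ N = (N + 1ℚ) * (N + 1ℚ) * (N + 1ℚ)
      pR₁ : ℚ → ℚ
      pR₁ N = m27 * qL₁ N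
      pR₀ : ℚ → ℚ
      pR₀ N = m27 * (m27 * qL₀ N)
      PR : ℚ → ℚ → ℚ
      PR K M = - (+ 6 / 1) * (+ 2 / 1 * K + + 2 / 1 * M - 1ℚ) * (+ 3 / 1 * K - 1ℚ) * (+ 3 / 1 * K - + 2 / 1)
      absorbFactor : ℚ → ℚ → ℚ
      absorbFactor J K = m27 * (J + + 2 / 1 * K + 1ℚ)
      shiftFactor : ℚ → ℚ → ℚ
      shiftFactor T U = + 3 / 1 * ((T + 1ℚ + 1ℚ) * (T + 1ℚ)) * ((U + 1ℚ + 1ℚ) * (U + 1ℚ))
  in (∀ J → (qL₂ J * absorbFactor (J + 1ℚ) 0ℚ + (pR₁ J - PR (0ℚ + 1ℚ) (J + 1ℚ)) * (J + 1ℚ + 1ℚ))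
                * absorbFactor J 0ℚ
              + pR₀ J * (J + 1ℚ + 1ℚ) * (J + 1ℚ) ≡ 0ℚ)
     × (∀ K J →
          ((PR (K + 1ℚ) (J + 1ℚ + 1ℚ) * sq (sq (K + 1ℚ))
              + qL₂ (K + J + 1ℚ) * shiftFactor (+ 3 / 1 * K) (J + 1ℚ + 1ℚ + + 2 / 1 * K)) * absorbFactor (J + 1ℚ) (K + 1ℚ)
            + (pR₁ (K + J + 1ℚ) - PR (K + 1ℚ + 1ℚ) (J + 1ℚ))
                * shiftFactor (+ 3 / 1 * K) (J + 1ℚ + 1ℚ + + 2 / 1 * K) * (J + 1ℚ + 1ℚ)) * absorbFactor J (K + 1ℚ)
          + pR₀ (K + J + 1ℚ) * shiftFactor (+ 3 / 1 * K) (J + 1ℚ + 1ℚ + + 2 / 1 * K) * (J + 1ℚ + 1ℚ) * (J + 1ℚ) ≡ 0ℚ)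
     × (∀ N →
          (qL₂ N * shiftFactor (+ 3 / 1 * (N + 1ℚ)) (0ℚ + + 2 / 1 * (N + 1ℚ))
            + (qL₂ N * absorbFactor 0ℚ (N + 1ℚ) + pR₁ N) * sq (sq (N + 1ℚ + 1ℚ)))
              * shiftFactor (+ 3 / 1 * N) (0ℚ + + 2 / 1 * N)
          + PR (N + 1ℚ) (0ℚ + 1ℚ) * absorbFactor 0ℚ N * sq (sq (N + 1ℚ + 1ℚ)) * sq (sq (N + 1ℚ)) ≡ 0ℚ)
polynomialIdentitiesR = solve-∀ ℚ-ring , solve-∀ ℚ-ring , solve-∀ ℚ-ring

interiorR : ∀ k j →
  qL₂ (ι (k ℕ.+ j)) * termR k (2 ℕ.+ j) + pR₁ (ι (k ℕ.+ j)) * termR k (1 ℕ.+ j) + pR₀ (ι (k ℕ.+ j)) * termR k j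
    ≡ certR (suc k) (suc j) - certR k (2 ℕ.+ j)
interiorR zero j = begin
  qL₂ J * x₂ + pR₁ J * x₁ + pR₀ J * x₀
    ≡⟨ expand (qL₂ J) (pR₁ J) (pR₀ J) (PR (0ℚ + 1ℚ) (J + 1ℚ)) x₀ x₁ x₂ ⟩
  R + (qL₂ J * x₂ + ((pR₁ J - PR (0ℚ + 1ℚ) (J + 1ℚ)) * x₁ + pR₀ J * x₀))
    ≡⟨ cong (λ t → R + t) vanishing ⟩
  R + 0ℚ
    ≡⟨ ℚₚ.+-identityʳ R ⟩
  R ∎
  where
  open ≡-Reasoning
  J = ι j
  x₀ = termR 0 j
  x₁ = termR 0 (1 ℕ.+ j)
  x₂ = termR 0 (2 ℕ.+ j)
  R = PR (0ℚ + 1ℚ) (J + 1ℚ) * x₁ - 0ℚ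
  expand : ∀ q₂ p₁ p₀ P x₀ x₁ x₂ →
    q₂ * x₂ + p₁ * x₁ + p₀ * x₀ ≡ (P * x₁ - 0ℚ) + (q₂ * x₂ + ((p₁ - P) * x₁ + p₀ * x₀))
  expand = solve-∀ ℚ-ring
  vanishing : qL₂ J * x₂ + ((pR₁ J - PR (0ℚ + 1ℚ) (J + 1ℚ)) * x₁ + pR₀ J * x₀) ≡ 0ℚ
  vanishing = vanish₃ x₂ x₁ x₀
    (J + 1ℚ + 1ℚ) (absorbFactor (J + 1ℚ) 0ℚ) (J + 1ℚ) (absorbFactor J 0ℚ)
    (qL₂ J) (pR₁ J - PR (0ℚ + 1ℚ) (J + 1ℚ)) (pR₀ J)
    {{ι-suc-nonZero j}} {{ι-suc-nonZero (suc j)}}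
    (termR-suc 0 j) (termR-suc 0 (suc j)) (proj₁ polynomialIdentitiesR J)
interiorR (suc k) j = begin
  shape (ι (k ℕ.+ j))
    ≡⟨ cong shape (ι-+ k j) ⟩
  shape (K + J)
    ≡⟨ expand c₂ (pR₁ (K + J + 1ℚ)) c₀ (PR (K + 1ℚ + 1ℚ) (J + 1ℚ)) c₃ x₀ x₁ x₂ x₃ ⟩
  R + (c₃ * x₃ + (c₂ * x₂ + (c₁ * x₁ + c₀ * x₀)))
    ≡⟨ cong (λ t → R + t) vanishing ⟩
  R + 0ℚ
    ≡⟨ ℚₚ.+-identityʳ R ⟩
  R ∎
  where
  open ≡-Reasoning
  K = ι k
  J = ι j
  x₀ = termR (suc k) j
  x₁ = termR (suc k) (1 ℕ.+ j)
  x₂ = termR (suc k) (2 ℕ.+ j)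
  x₃ = termR k (2 ℕ.+ j)
  shape : ℚ → ℚ
  shape N = qL₂ (N + 1ℚ) * x₂ + pR₁ (N + 1ℚ) * x₁ + pR₀ (N + 1ℚ) * x₀
  R = PR (K + 1ℚ + 1ℚ) (J + 1ℚ) * x₁ - PR (K + 1ℚ) (J + 1ℚ + 1ℚ) * x₃
  c₃ = PR (K + 1ℚ) (J + 1ℚ + 1ℚ)
  c₂ = qL₂ (K + J + 1ℚ)
  c₁ = pR₁ (K + J + 1ℚ) - PR (K + 1ℚ + 1ℚ) (J + 1ℚ)
  c₀ = pR₀ (K + J + 1ℚ)
  expand : ∀ q₂ p₁ p₀ P₁ P₂ x₀ x₁ x₂ x₃ →
    q₂ * x₂ + p₁ * x₁ + p₀ * x₀ ≡ (P₁ * x₁ - P₂ * x₃) + (P₂ * x₃ + (q₂ * x₂ + ((p₁ - P₁) * x₁ + p₀ * x₀)))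
  expand = solve-∀ ℚ-ring
  vanishing : c₃ * x₃ + (c₂ * x₂ + (c₁ * x₁ + c₀ * x₀)) ≡ 0ℚ
  vanishing = vanish₄ x₃ x₂ x₁ x₀
    (shiftFactor (+ 3 / 1 * K) (J + 1ℚ + 1ℚ + + 2 / 1 * K)) (sq (sq (K + 1ℚ)))
    (J + 1ℚ + 1ℚ) (absorbFactor (J + 1ℚ) (K + 1ℚ)) (J + 1ℚ) (absorbFactor J (K + 1ℚ))
    c₃ c₂ c₁ c₀
    {{ι-suc-nonZero j}} {{ι-suc-nonZero (suc j)}} {{shiftFactor-nonZero k (2 ℕ.+ j)}}
    (termR-suc (suc k) j) (termR-suc (suc k) (suc j)) (sym (termR-shift k (2 ℕ.+ j)))
    (proj₁ (proj₂ polynomialIdentitiesR) K J)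

boundaryR : ∀ n →
  certR (suc n) 1 + qL₂ (ι n) * (termR (suc n) 1 + termR (2 ℕ.+ n) 0) + pR₁ (ι n) * termR (suc n) 0 ≡ 0ℚ
boundaryR n = begin
  PR (N + 1ℚ) (0ℚ + 1ℚ) * termR n 1 + qL₂ N * (termR (suc n) 1 + x₂) + pR₁ N * x₁
    ≡⟨ cong₂ (λ y z → PR (N + 1ℚ) (0ℚ + 1ℚ) * y + qL₂ N * (z + x₂) + pR₁ N * x₁)
             (termR-one n) (termR-one (suc n)) ⟩
  PR (N + 1ℚ) (0ℚ + 1ℚ) * (absorbFactor 0ℚ N * x₀) + qL₂ N * (absorbFactor 0ℚ (N + 1ℚ) * x₁ + x₂) + pR₁ N * x₁
    ≡⟨ expand (PR (N + 1ℚ) (0ℚ + 1ℚ)) (absorbFactor 0ℚ N) (absorbFactor 0ℚ (N + 1ℚ)) (qL₂ N) (pR₁ N)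
              x₀ x₁ x₂ ⟩
  qL₂ N * x₂ + ((qL₂ N * absorbFactor 0ℚ (N + 1ℚ) + pR₁ N) * x₁ + PR (N + 1ℚ) (0ℚ + 1ℚ) * absorbFactor 0ℚ N * x₀)
    ≡⟨ vanishing ⟩
  0ℚ ∎
  where
  open ≡-Reasoning
  N = ι n
  x₀ = termR n 0
  x₁ = termR (suc n) 0
  x₂ = termR (2 ℕ.+ n) 0
  expand : ∀ P a₀ a₁ q₂ p₁ x₀ x₁ x₂ →
    P * (a₀ * x₀) + q₂ * (a₁ * x₁ + x₂) + p₁ * x₁ ≡ q₂ * x₂ + ((q₂ * a₁ + p₁) * x₁ + P * a₀ * x₀)
  expand = solve-∀ ℚ-ring
  vanishing = vanish₃ x₂ x₁ x₀
    (sq (sq (N + 1ℚ + 1ℚ))) (shiftFactor (+ 3 / 1 * (N + 1ℚ)) (0ℚ + + 2 / 1 * (N + 1ℚ)))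
    (sq (sq (N + 1ℚ))) (shiftFactor (+ 3 / 1 * N) (0ℚ + + 2 / 1 * N))
    (qL₂ N) (qL₂ N * absorbFactor 0ℚ (N + 1ℚ) + pR₁ N) (PR (N + 1ℚ) (0ℚ + 1ℚ) * absorbFactor 0ℚ N)
    {{sq-nonZero (sq (N + 1ℚ)) {{sq-positive (N + 1ℚ) {{ι-suc-positive n}}}}}}
    {{sq-nonZero (sq (N + 1ℚ + 1ℚ)) {{sq-positive (N + 1ℚ + 1ℚ) {{ι-suc-positive (suc n)}}}}}}
    (termR-shift n 0) (termR-shift (suc n) 0) (proj₂ (proj₂ polynomialIdentitiesR) N)

termR-recurrence : SatisfiesRecurrence (qL₂ ∘ ι) (pR₁ ∘ ι) (pR₀ ∘ ι) (antidiagonalSum termR)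
termR-recurrence =
  antidiagonalSum-recurrence (qL₂ ∘ ι) (pR₁ ∘ ι) (pR₀ ∘ ι) termR certR interiorR (λ _ → refl) boundaryR

rhsTerm≡termR : ∀ n k → k ≤ n → rhsTerm n k ≡ termR k (n ∸ k)
rhsTerm≡termR n k k≤n = begin
  ℕ→ℚ (weightR k ℕ.* binomial) * m27 ^ℚ (n ∸ k)
    ≡⟨ cong (_* m27 ^ℚ (n ∸ k)) (trans (ℕ→ℚ≡ι (weightR k ℕ.* binomial)) (ι-* (weightR k) binomial)) ⟩
  ι (weightR k) * ι ((n ℕ.+ k) C (n ∸ k)) * m27 ^ℚ (n ∸ k)
    ≡⟨ cong (λ m → ι (weightR k) * ι (m C (n ∸ k)) * m27 ^ℚ (n ∸ k)) top ⟩
  termR k (n ∸ k) ∎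
  where
  open ≡-Reasoning
  binomial = (n ℕ.+ k) C (n ∸ k)
  top : n ℕ.+ k ≡ (n ∸ k) ℕ.+ 2 ℕ.* k
  top = trans (cong (ℕ._+ k) (sym (ℕₚ.m+[n∸m]≡n k≤n))) (rearrange k (n ∸ k))
    where
    rearrange : ∀ k j → k ℕ.+ j ℕ.+ k ≡ j ℕ.+ 2 ℕ.* k
    rearrange = ℕSolver.solve-∀

qL₂-nonZero : ∀ n → NonZero (qL₂ (ι n))
qL₂-nonZero n = ℚₚ.pos⇒nonZero (qL₂ (ι n)) {{cube}}
  where
  shifted : Positive (ι n + + 2 / 1)
  shifted = ℚₚ.nonNeg+pos⇒pos (ι n) {{ι-nonNegative n}} (+ 2 / 1)
  square : Positive ((ι n + + 2 / 1) * (ι n + + 2 / 1))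
  square = ℚₚ.pos*pos⇒pos (ι n + + 2 / 1) {{shifted}} (ι n + + 2 / 1) {{shifted}}
  cube : Positive (qL₂ (ι n))
  cube = ℚₚ.pos*pos⇒pos ((ι n + + 2 / 1) * (ι n + + 2 / 1)) {{square}} (ι n + + 2 / 1) {{shifted}}

mainTheorem7 : (n : ℕ) →
    (m27 ^ℚ n) * sumTo n (lhsTerm n) ≡ sumTo n (rhsTerm n)
mainTheorem7 n = begin
  m27 ^ℚ n * sumTo n (lhsTerm n)
    ≡⟨ cong (m27 ^ℚ n *_) (sumTo-cong n (λ k _ → lhsTerm≡termL n k)) ⟩
  m27 ^ℚ n * antidiagonalSum termL n
    ≡⟨ SatisfiesRecurrence-unique qL₂-nonZero
         (SatisfiesRecurrence-twist m27 termL-recurrence) termR-recurrence refl refl n ⟩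
  antidiagonalSum termR n
    ≡⟨ sym (sumTo-cong n (rhsTerm≡termR n)) ⟩
  sumTo n (rhsTerm n) ∎
  where open ≡-Reasoning
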